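{- Let $A$ be an $H^{\vee,\triangle}_3$-algebra and $a,b,c\in A$. Then: (1) if $a\to b=1$ then $a\vee b=b$; (2) if $a\to c=1$ and $b\to c=1$ then $(a\vee b)\to c=1$; (3) $a\to(a\vee b)=1$; (4) $(a\to c)\to((b\to c)\to((a\vee b)\to c))=1$; (5) $\triangle(a\vee b)=\triangle a\vee\triangle b$; (6) $\nabla(a\vee b)=\nabla a\vee\nabla b$.
   Context: An $H^{\vee,\triangle}_3$-algebra is an algebra $(A,\to,\vee,\triangle,1)$ such that: $(A,\vee,1)$ is a join-semilattice with top $1$; $x\to(x\vee y)=1$ and $(x\to y)\to((x\vee y)\to y)=1$; whenever the infimum $x\wedge y$ exists, $\triangle(x\wedge y)=\triangle x\wedge\triangle y$; $(A,\to,1)$ satisfies $x\to(y\to x)=1$, $(x\to(y\to z))\to((x\to y)\to(x\to z))=1$, ($x\to y=1=y\to x$ implies $x=y$), and $((x\to y)\to z)\to(((z\to x)\to z)\to z)=1$; and $\triangle x\to x=1$, $((y\to\triangle y)\to(x\to\triangle\triangle x))\to\triangle(x\to y)=\triangle x\to\triangle\triangle y$, $(\triangle x\to\triangle y)\to\triangle x=\triangle x$. $\nabla x:=(x\to\triangle x)\to\triangle x$. -}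

module Defs where

open import Level using (Level; suc; _⊔_)
open import Relation.Binary.PropositionalEquality using (_≡_)
open import Data.Product using (_×_)

module _ {a : Level} {A : Set a} (_∨_ : A → A → A) where

  _≤∨_ : A → A → Set a
  x ≤∨ y = (x ∨ y) ≡ y

  IsInf : A → A → A → Set a
  IsInf x y m = (m ≤∨ x) × (m ≤∨ y) × (∀ z → z ≤∨ x → z ≤∨ y → z ≤∨ m)

record H3∨△Algebra (a : Level) : Set (suc a) where
  infixr 5 _⇒_
  infixl 6 _∨_
  field
    Carrier : Set a
    _⇒_     : Carrier → Carrier → Carrier
    _∨_     : Carrier → Carrier → Carrier
    △       : Carrier → Carrier
    𝟏       : Carrier

    ∨-assoc : ∀ x y z → (x ∨ y) ∨ z ≡ x ∨ (y ∨ z)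
    ∨-comm  : ∀ x y → x ∨ y ≡ y ∨ x
    ∨-idem  : ∀ x → x ∨ x ≡ x
    ∨-top   : ∀ x → x ∨ 𝟏 ≡ 𝟏

    J1 : ∀ x y → x ⇒ (x ∨ y) ≡ 𝟏
    J2 : ∀ x y → (x ⇒ y) ⇒ ((x ∨ y) ⇒ y) ≡ 𝟏

    △-inf : ∀ x y m → IsInf _∨_ x y m → IsInf _∨_ (△ x) (△ y) (△ m)

    H1 : ∀ x y → x ⇒ (y ⇒ x) ≡ 𝟏
    H2 : ∀ x y z → (x ⇒ (y ⇒ z)) ⇒ ((x ⇒ y) ⇒ (x ⇒ z)) ≡ 𝟏
    H3 : ∀ x y → x ⇒ y ≡ 𝟏 → y ⇒ x ≡ 𝟏 → x ≡ y
    H4 : ∀ x y z → ((x ⇒ y) ⇒ z) ⇒ (((z ⇒ x) ⇒ z) ⇒ z) ≡ 𝟏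

    D1 : ∀ x → △ x ⇒ x ≡ 𝟏
    D2 : ∀ x y → ((y ⇒ △ y) ⇒ (x ⇒ △ (△ x))) ⇒ △ (x ⇒ y) ≡ △ x ⇒ △ (△ y)
    D3 : ∀ x y → (△ x ⇒ △ y) ⇒ △ x ≡ △ x

  ∇ : Carrier → Carrier
  ∇ x = (x ⇒ △ x) ⇒ △ x

module Submission where

-- The implicative reduct is a Hilbert algebra, so the deduction theorem holds and valid
-- implications can be derived by natural deduction. The join is the least upper bound
-- of the order x ≤ y ⟺ x ⇒ y = 1, which gives (1)–(4). For (5), △ is monotone and
-- idempotent and satisfies △(x ⇒ y) = △x ⇒ △y up to the factor (y ⇒ △y) ⇒ (x ⇒ △x);
-- reasoning by cases towards a fixed point z = △z (where Peirce's law holds) yields the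
-- prelinearity (△(x ⇒ y) ⇒ z) ⇒ ((△(y ⇒ x) ⇒ z) ⇒ z), and the two cases a ⇒ b, b ⇒ a
-- bound △(a ∨ b) by △a ∨ △b. For (6), ∇a ∨ ∇b is a fixed point of △ lying above
-- △(a ∨ b), a and b, and the same reasoning by cases, on ∇a ⇒ △(a ∨ b) and ∇b ⇒ △(a ∨ b),
-- bounds ∇(a ∨ b) by it.

open import Data.Product using (_×_; _,_; proj₁; proj₂)
open import Level using (Level)
open import Relation.Binary.PropositionalEquality
  using (_≡_; sym; trans; cong; cong₂; subst; module ≡-Reasoning)

open import Defs

module Properties {ℓ : Level} (𝔸 : H3∨△Algebra ℓ) where
  open H3∨△Algebra 𝔸
  open ≡-Reasoning

  infix 4 _≤_
  _≤_ : Carrier → Carrier → Set ℓ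
  x ≤ y = x ⇒ y ≡ 𝟏

  ≤-𝟏 : ∀ x → x ≤ 𝟏
  ≤-𝟏 x = H3 (x ⇒ 𝟏) 𝟏 (trans (cong ((x ⇒ 𝟏) ⇒_) (sym (H1 𝟏 x))) (H1 (x ⇒ 𝟏) 𝟏)) (H1 𝟏 x)

  modus-ponens : ∀ {x y} → x ≡ 𝟏 → x ≤ y → y ≡ 𝟏
  modus-ponens {x} {y} x≡𝟏 x≤y = H3 y 𝟏 (≤-𝟏 y) (subst (_≤ y) x≡𝟏 x≤y)

  ≤-refl : ∀ x → x ≤ x
  ≤-refl x = modus-ponens (H1 x x) (modus-ponens (H1 x (x ⇒ x)) (H2 x (x ⇒ x) x))

  𝟏⇒x≡x : ∀ x → 𝟏 ⇒ x ≡ x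
  𝟏⇒x≡x x = H3 _ _ 𝟏⇒x≤x (H1 x 𝟏)
    where
    𝟏⇒x≤x : 𝟏 ⇒ x ≤ x
    𝟏⇒x≤x = modus-ponens (≤-𝟏 (𝟏 ⇒ x)) (modus-ponens (≤-refl (𝟏 ⇒ x)) (H2 (𝟏 ⇒ x) 𝟏 x))

  module Deduction where

    infixl 4 _▸_
    data Context : Set ℓ where
      ε   : Context
      _▸_ : Context → Carrier → Context

    ⟦_⟧ : Context → Carrier → Carrier
    ⟦ ε ⟧ φ     = φ
    ⟦ Γ ▸ g ⟧ φ = ⟦ Γ ⟧ (g ⇒ φ)

    -- A data type rather than a definition, so that Γ and φ can be inferred.
    infix 2 _⊢_
    data _⊢_ (Γ : Context) (φ : Carrier) : Set ℓ where
      derivation : ⟦ Γ ⟧ φ ≡ 𝟏 → Γ ⊢ φ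

    private
      valid-under : ∀ Γ {φ} → φ ≡ 𝟏 → ⟦ Γ ⟧ φ ≡ 𝟏
      valid-under ε       φ≡𝟏 = φ≡𝟏
      valid-under (Γ ▸ g) φ≡𝟏 = valid-under Γ (trans (cong (g ⇒_) φ≡𝟏) (≤-𝟏 g))

      detach-under : ∀ Γ {φ ψ} → ⟦ Γ ⟧ (φ ⇒ ψ) ≡ 𝟏 → ⟦ Γ ⟧ φ ≡ 𝟏 → ⟦ Γ ⟧ ψ ≡ 𝟏
      detach-under ε       ⊢φ⇒ψ ⊢φ = modus-ponens ⊢φ ⊢φ⇒ψ
      detach-under (Γ ▸ g) {φ} {ψ} ⊢φ⇒ψ ⊢φ =
        detach-under Γ (detach-under Γ (valid-under Γ (H2 g φ ψ)) ⊢φ⇒ψ) ⊢φ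

    valid : ∀ {Γ φ} → φ ≡ 𝟏 → Γ ⊢ φ
    valid {Γ} φ≡𝟏 = derivation (valid-under Γ φ≡𝟏)

    app : ∀ {Γ φ ψ} → Γ ⊢ φ ⇒ ψ → Γ ⊢ φ → Γ ⊢ ψ
    app {Γ} (derivation ⊢φ⇒ψ) (derivation ⊢φ) = derivation (detach-under Γ ⊢φ⇒ψ ⊢φ)

    lam : ∀ {Γ g ψ} → Γ ▸ g ⊢ ψ → Γ ⊢ g ⇒ ψ
    lam (derivation ⊢ψ) = derivation ⊢ψ

    unlam : ∀ {Γ g ψ} → Γ ⊢ g ⇒ ψ → Γ ▸ g ⊢ ψ
    unlam (derivation ⊢g⇒ψ) = derivation ⊢g⇒ψ

    apply : ∀ {Γ φ ψ} → φ ≤ ψ → Γ ⊢ φ → Γ ⊢ ψ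
    apply φ≤ψ = app (valid φ≤ψ)

    weaken : ∀ {Γ g ψ} → Γ ⊢ ψ → Γ ▸ g ⊢ ψ
    weaken {g = g} {ψ} ⊢ψ = unlam (apply (H1 ψ g) ⊢ψ)

    var₀ : ∀ {Γ g} → Γ ▸ g ⊢ g
    var₀ {Γ} {g} = derivation (valid-under Γ (≤-refl g))

    var₁ : ∀ {Γ g h} → Γ ▸ g ▸ h ⊢ g
    var₁ = weaken var₀

    var₂ : ∀ {Γ g h k} → Γ ▸ g ▸ h ▸ k ⊢ g
    var₂ = weaken var₁

    var₃ : ∀ {Γ g h k l} → Γ ▸ g ▸ h ▸ k ▸ l ⊢ g
    var₃ = weaken var₂

    closed : ∀ {φ} → ε ⊢ φ → φ ≡ 𝟏
    closed (derivation ⊢φ) = ⊢φ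

  open Deduction

  ≤-trans : ∀ {x y z} → x ≤ y → y ≤ z → x ≤ z
  ≤-trans x≤y y≤z = closed (lam (apply y≤z (apply x≤y var₀)))

  contraction : ∀ {x y} → x ≤ x ⇒ y → x ≤ y
  contraction x≤x⇒y = closed (lam (app (apply x≤x⇒y var₀) var₀))

  x≤x∨y : ∀ x y → x ≤ x ∨ y
  x≤x∨y = J1

  y≤x∨y : ∀ x y → y ≤ x ∨ y
  y≤x∨y x y = subst (y ≤_) (∨-comm y x) (J1 y x)

  ≤⇒∨≡ : ∀ {x y} → x ≤ y → x ∨ y ≡ y
  ≤⇒∨≡ {x} {y} x≤y = H3 _ _ (modus-ponens x≤y (J2 x y)) (y≤x∨y x y)

  ∨≡⇒≤ : ∀ {x y} → x ∨ y ≡ y → x ≤ y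
  ∨≡⇒≤ {x} x∨y≡y = subst (x ≤_) x∨y≡y (J1 x _)

  ∨-least : ∀ {x y z} → x ≤ z → y ≤ z → x ∨ y ≤ z
  ∨-least {x} {y} {z} x≤z y≤z = ∨≡⇒≤ (begin
    x ∨ y ∨ z    ≡⟨ ∨-assoc x y z ⟩
    x ∨ (y ∨ z)  ≡⟨ cong (x ∨_) (≤⇒∨≡ y≤z) ⟩
    x ∨ z        ≡⟨ ≤⇒∨≡ x≤z ⟩
    z            ∎)

  ∨-elim : ∀ x y z → x ⇒ z ≤ (y ⇒ z) ⇒ (x ∨ y ⇒ z)
  ∨-elim x y z = closed (lam (lam (lam (app (app (apply x∨y≤cases var₀) var₂) var₁))))
    where
    x∨y≤cases : x ∨ y ≤ (x ⇒ z) ⇒ ((y ⇒ z) ⇒ z)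
    x∨y≤cases = ∨-least (closed (lam (lam (lam (app var₁ var₂)))))
                        (closed (lam (lam (lam (app var₀ var₂)))))

  ∨-≤-⇒ʳ : ∀ x y → x ∨ y ≤ (x ⇒ y) ⇒ y
  ∨-≤-⇒ʳ x y = closed (lam (lam (app (apply (J2 x y) var₀) var₁)))

  ∨-≤-⇒ˡ : ∀ x y → x ∨ y ≤ (y ⇒ x) ⇒ x
  ∨-≤-⇒ˡ x y = subst (_≤ (y ⇒ x) ⇒ x) (∨-comm y x) (∨-≤-⇒ʳ y x)

  △-Fixed : Carrier → Set ℓ
  △-Fixed x = △ x ≡ x

  △-mono : ∀ {x y} → x ≤ y → △ x ≤ △ y
  △-mono {x} {y} x≤y =
    ∨≡⇒≤ (proj₁ (proj₂ (△-inf x y x (∨-idem x , ≤⇒∨≡ x≤y , λ _ z≤x _ → z≤x))))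

  -- D3 and D2 at x = y = 𝟏 both reduce to (t ⇒ △t) ⇒ t for t = △𝟏.
  △𝟏 : △ 𝟏 ≡ 𝟏
  △𝟏 = trans t≡t⇒T (contraction (subst (t ≤_) t≡t⇒T (≤-refl t)))
    where
    t = △ 𝟏
    T = △ t
    t≡t⇒T : t ≡ t ⇒ T
    t≡t⇒T = begin
      t                                     ≡⟨ sym (D3 𝟏 t) ⟩
      (t ⇒ T) ⇒ t                           ≡⟨ sym (cong₂ _⇒_ (cong₂ _⇒_ (𝟏⇒x≡x t) (𝟏⇒x≡x T))
                                                              (cong △ (≤-refl 𝟏))) ⟩
      ((𝟏 ⇒ t) ⇒ (𝟏 ⇒ T)) ⇒ △ (𝟏 ⇒ 𝟏)       ≡⟨ D2 𝟏 𝟏 ⟩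
      t ⇒ T                                 ∎

  △-idem : ∀ x → △-Fixed (△ x)
  △-idem x = H3 _ _ (D1 (△ x)) (begin
    △ x ⇒ △ (△ x)                                           ≡⟨ sym (D2 x x) ⟩
    ((x ⇒ △ x) ⇒ (x ⇒ △ (△ x))) ⇒ △ (x ⇒ x)                 ≡⟨ cong (((x ⇒ △ x) ⇒ (x ⇒ △ (△ x))) ⇒_)
                                                                 (trans (cong △ (≤-refl x)) △𝟏) ⟩
    ((x ⇒ △ x) ⇒ (x ⇒ △ (△ x))) ⇒ 𝟏                         ≡⟨ ≤-𝟏 _ ⟩
    𝟏                                                       ∎)

  △-⇒ : ∀ x y → ((y ⇒ △ y) ⇒ (x ⇒ △ x)) ⇒ △ (x ⇒ y) ≡ △ x ⇒ △ y
  △-⇒ x y = begin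
    ((y ⇒ △ y) ⇒ (x ⇒ △ x)) ⇒ △ (x ⇒ y)        ≡⟨ cong (λ v → ((y ⇒ △ y) ⇒ (x ⇒ v)) ⇒ △ (x ⇒ y))
                                                     (sym (△-idem x)) ⟩
    ((y ⇒ △ y) ⇒ (x ⇒ △ (△ x))) ⇒ △ (x ⇒ y)    ≡⟨ D2 x y ⟩
    △ x ⇒ △ (△ y)                              ≡⟨ cong (△ x ⇒_) (△-idem y) ⟩
    △ x ⇒ △ y                                  ∎

  △-distrib-⇒ : ∀ x y → △ (x ⇒ y) ≤ △ x ⇒ △ y
  △-distrib-⇒ x y = subst (△ (x ⇒ y) ≤_) (△-⇒ x y) (H1 (△ (x ⇒ y)) _)

  △-⇒-fixedˡ : ∀ {z} y → △-Fixed z → △ (z ⇒ y) ≡ z ⇒ △ y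
  △-⇒-fixedˡ {z} y z-fixed = begin
    △ (z ⇒ y)                                ≡⟨ sym (𝟏⇒x≡x _) ⟩
    𝟏 ⇒ △ (z ⇒ y)                            ≡⟨ cong (_⇒ △ (z ⇒ y)) (sym (≤-𝟏 (y ⇒ △ y))) ⟩
    ((y ⇒ △ y) ⇒ 𝟏) ⇒ △ (z ⇒ y)              ≡⟨ cong (λ v → ((y ⇒ △ y) ⇒ v) ⇒ △ (z ⇒ y))
                                                  (sym (subst (z ≤_) (sym z-fixed) (≤-refl z))) ⟩
    ((y ⇒ △ y) ⇒ (z ⇒ △ z)) ⇒ △ (z ⇒ y)      ≡⟨ △-⇒ z y ⟩
    △ z ⇒ △ y                                ≡⟨ cong (_⇒ △ y) z-fixed ⟩
    z ⇒ △ y                                  ∎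

  ∨-fixed : ∀ {x y} → △-Fixed x → △-Fixed y → △-Fixed (x ∨ y)
  ∨-fixed {x} {y} x-fixed y-fixed = H3 _ _ (D1 _)
    (∨-least (subst (_≤ △ (x ∨ y)) x-fixed (△-mono (x≤x∨y x y)))
             (subst (_≤ △ (x ∨ y)) y-fixed (△-mono (y≤x∨y x y))))

  -- D3 says that z ⇒ △q ≤ z, and △q ≤ q.
  peirce-fixed : ∀ {z} q → △-Fixed z → (z ⇒ q) ⇒ z ≤ z
  peirce-fixed {z} q z-fixed = subst ((z ⇒ q) ⇒ z ≤_) D3-fixed weaker
    where
    D3-fixed : (z ⇒ △ q) ⇒ z ≡ z
    D3-fixed = subst (λ v → (v ⇒ △ q) ⇒ v ≡ v) z-fixed (D3 z q)
    weaker : (z ⇒ q) ⇒ z ≤ (z ⇒ △ q) ⇒ z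
    weaker = closed (lam (lam (app var₁ (lam (apply (D1 q) (app var₁ var₀))))))

  cases-fixed : ∀ {z} x y → △-Fixed z → x ⇒ z ≤ ((x ⇒ y) ⇒ z) ⇒ z
  cases-fixed {z} x y z-fixed =
    closed (lam (lam (app (valid (peirce-fixed y z-fixed))
                          (lam (app var₁ (lam (app var₁ (app var₃ var₀))))))))

  △-prelinear : ∀ {z} x y → △-Fixed z → △ (x ⇒ y) ⇒ z ≤ (△ (y ⇒ x) ⇒ z) ⇒ z
  △-prelinear {z} x y z-fixed =
    closed (lam (lam (app (app (valid (cases-fixed α β z-fixed)) case-α) case-α⇒β)))
    where
    s = △ (x ⇒ y)
    r = △ (y ⇒ x)
    α = x ⇒ △ x
    β = y ⇒ △ y
    △x⇒△y≤ : △ x ⇒ △ y ≤ (β ⇒ α) ⇒ s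
    △x⇒△y≤ = subst (_≤ (β ⇒ α) ⇒ s) (△-⇒ x y) (≤-refl _)
    △y⇒△x≤ : △ y ⇒ △ x ≤ (α ⇒ β) ⇒ r
    △y⇒△x≤ = subst (_≤ (α ⇒ β) ⇒ r) (△-⇒ y x) (≤-refl _)
    case-α : ε ▸ s ⇒ z ▸ r ⇒ z ⊢ α ⇒ z
    case-α = lam (app (app (valid (cases-fixed (△ x) (△ y) z-fixed))
                           (lam (app var₂ (apply (△-mono (H1 x y)) var₀))))
                      (lam (app var₃ (app (apply △x⇒△y≤ var₀) (lam var₂)))))
    case-α⇒β : ε ▸ s ⇒ z ▸ r ⇒ z ⊢ (α ⇒ β) ⇒ z
    case-α⇒β = lam (app (app (valid (cases-fixed (△ y) (△ x) z-fixed))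
                             (lam (app var₃ (apply (△-mono (H1 y x)) var₀))))
                        (lam (app var₂ (app (apply △y⇒△x≤ var₀) var₁))))

  △-∨ : ∀ x y → △ (x ∨ y) ≡ △ x ∨ △ y
  △-∨ x y = H3 _ _ △x∨y≤ (∨-least (△-mono (x≤x∨y x y)) (△-mono (y≤x∨y x y)))
    where
    △x∨y≤△[x⇒y]⇒△y : △ (x ∨ y) ≤ △ (x ⇒ y) ⇒ △ y
    △x∨y≤△[x⇒y]⇒△y = ≤-trans (△-mono (∨-≤-⇒ʳ x y)) (△-distrib-⇒ (x ⇒ y) y)
    △x∨y≤△[y⇒x]⇒△x : △ (x ∨ y) ≤ △ (y ⇒ x) ⇒ △ x
    △x∨y≤△[y⇒x]⇒△x = ≤-trans (△-mono (∨-≤-⇒ˡ x y)) (△-distrib-⇒ (y ⇒ x) x)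
    △x∨y≤ : △ (x ∨ y) ≤ △ x ∨ △ y
    △x∨y≤ = closed (lam (app (app (valid (△-prelinear x y (∨-fixed (△-idem x) (△-idem y))))
      (lam (apply (y≤x∨y (△ x) (△ y)) (app (apply △x∨y≤△[x⇒y]⇒△y var₁) var₀))))
      (lam (apply (x≤x∨y (△ x) (△ y)) (app (apply △x∨y≤△[y⇒x]⇒△x var₁) var₀)))))

  ⇒△-fixed : ∀ y → △-Fixed (y ⇒ △ y)
  ⇒△-fixed y = H3 _ _ (D1 _) (begin
    (y ⇒ △ y) ⇒ △ (y ⇒ △ y)                        ≡⟨ cong (_⇒ △ (y ⇒ △ y)) (sym (𝟏⇒x≡x _)) ⟩
    (𝟏 ⇒ (y ⇒ △ y)) ⇒ △ (y ⇒ △ y)                  ≡⟨ cong (λ v → (v ⇒ (y ⇒ △ y)) ⇒ △ (y ⇒ △ y))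
                                                          (sym △y≤△△y) ⟩
    ((△ y ⇒ △ (△ y)) ⇒ (y ⇒ △ y)) ⇒ △ (y ⇒ △ y)    ≡⟨ △-⇒ y (△ y) ⟩
    △ y ⇒ △ (△ y)                                  ≡⟨ △y≤△△y ⟩
    𝟏                                              ∎)
    where
    △y≤△△y : △ y ≤ △ (△ y)
    △y≤△△y = subst (△ y ≤_) (sym (△-idem y)) (≤-refl (△ y))

  ∇-fixed : ∀ x → △-Fixed (∇ x)
  ∇-fixed x = trans (△-⇒-fixedˡ (△ x) (⇒△-fixed x)) (cong ((x ⇒ △ x) ⇒_) (△-idem x))

  x≤∇x : ∀ x → x ≤ ∇ x
  x≤∇x x = closed (lam (lam (app var₀ var₁)))

  △x≤∇x : ∀ x → △ x ≤ ∇ x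
  △x≤∇x x = ≤-trans (D1 x) (x≤∇x x)

  ∇-mono : ∀ {x y} → x ≤ y → ∇ x ≤ ∇ y
  ∇-mono {x} {y} x≤y =
    closed (lam (lam (app (app (valid (cases-fixed (△ y) (△ x) (△-idem y))) (lam var₀))
      (lam (apply (△-mono x≤y) (app var₂ (lam (app var₁ (app var₂ (apply x≤y var₀))))))))))

  ∇-∨ : ∀ x y → ∇ (x ∨ y) ≡ ∇ x ∨ ∇ y
  ∇-∨ x y = H3 _ _ ∇x∨y≤ (∨-least (∇-mono (x≤x∨y x y)) (∇-mono (y≤x∨y x y)))
    where
    N = ∇ x ∨ ∇ y
    d = △ (x ∨ y)
    N-fixed : △-Fixed N
    N-fixed = ∨-fixed (∇-fixed x) (∇-fixed y)
    d≤N : d ≤ N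
    d≤N = subst (_≤ N) (sym (△-∨ x y))
      (∨-least (≤-trans (△x≤∇x x) (x≤x∨y (∇ x) (∇ y))) (≤-trans (△x≤∇x y) (y≤x∨y (∇ x) (∇ y))))
    -- In the innermost case ∇x ⇒ d and ∇y ⇒ d give x ∨ y ⇒ d, which ∇(x ∨ y) turns into d ≤ N.
    ∇x∨y≤ : ∇ (x ∨ y) ≤ N
    ∇x∨y≤ = closed (lam
      (app (app (valid (cases-fixed (∇ x) d N-fixed)) (lam (apply (x≤x∨y (∇ x) (∇ y)) var₀)))
        (lam (app (app (valid (cases-fixed (∇ y) d N-fixed)) (lam (apply (y≤x∨y (∇ x) (∇ y)) var₀)))
          (lam (apply d≤N (app var₂ (app (app (valid (∨-elim x y d))
                                                (lam (app var₂ (apply (x≤∇x x) var₀))))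
                                           (lam (app var₁ (apply (x≤∇x y) var₀)))))))))))

mainTheorem19 : ∀ {ℓ : Level} (𝔸 : H3∨△Algebra ℓ) → let open H3∨△Algebra 𝔸 in
    ∀ (a b c : Carrier) →
      (a ⇒ b ≡ 𝟏 → a ∨ b ≡ b)
      × (a ⇒ c ≡ 𝟏 → b ⇒ c ≡ 𝟏 → (a ∨ b) ⇒ c ≡ 𝟏)
      × (a ⇒ (a ∨ b) ≡ 𝟏)
      × ((a ⇒ c) ⇒ ((b ⇒ c) ⇒ ((a ∨ b) ⇒ c)) ≡ 𝟏)
      × (△ (a ∨ b) ≡ △ a ∨ △ b)
      × (∇ (a ∨ b) ≡ ∇ a ∨ ∇ b)
mainTheorem19 𝔸 a b c = ≤⇒∨≡ , ∨-least , x≤x∨y a b , ∨-elim a b c , △-∨ a b , ∇-∨ a b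
  where open Properties 𝔸
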